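{- Let $G$ be a ribbon graph without loops or multiple edges which is of type B, witnessed by a type II subgraph $H$ with vertices $c,a_1,\dots,a_n,f_1,\dots,f_k$, and write the cyclic ordering of the edges at $c$ in $G$ as $(ca_1,cx_1,\dots,cx_N,ca_n,cy_1,\dots,cy_M)$. Let $G_1$ be the subgraph of $G$ formed by all edges $e$ for which there is a path whose first edge is some $cx_i$, whose last edge is $e$, and which uses $c$ only at its endpoints. Then $$2\sum_{i=1}^{N}\big((x_i)-(c)\big)\not\sim_1 0,$$ i.e. this divisor is not linearly equivalent to $0$ on $G_1$.
   Context: A ribbon graph is a finite connected graph with, at each vertex, a cyclic ordering of the incident edges; subgraphs inherit it. Type II: distinct vertices $c,a_1,\dots,a_n,f_1,\dots,f_k$ and two closed paths $(c,a_1,\dots,a_n,c)$, $(c,f_1,\dots,f_k,c)$ meeting only at $c$, with first/last edges at $c$ denoted $ca_1,ca_n$ and $cf_1,cf_k$, the cyclic order at $c$ being $(ca_1,cf_k,ca_n,cf_1)$. Type B (with this $H$): in the decomposition above, $G_1$ contains none of $a_1,\dots,a_n$ (note $cf_k$ is among the $cx_i$ and $cf_1$ among the $cy_j$). A divisor on $G_1$ is a formal integer combination of its vertices; $\sim_1$ denotes linear equivalence on $G_1$: $D\sim_1 D'$ iff $D-D'$ lies in the subgroup generated by the divisors $\sum_{\overrightarrow{uv}\text{ an edge of }G_1\text{ oriented into }v}((v)-(u))$, $v\in V(G_1)$. -}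

module Defs where

open import Data.Nat using (ℕ)
open import Data.Fin using (Fin; _≟_)
open import Data.Bool using (Bool; true; false)
open import Data.List using (List; []; _∷_; _++_; filter; map; foldr)
open import Data.List.Relation.Unary.Unique.Propositional using (Unique)
open import Data.List.Relation.Unary.Linked using (Linked)
open import Data.List.Membership.Propositional using (_∈_; _∉_)
import Data.List.Membership.DecPropositional as DecMem
open import Data.Integer using (ℤ; +_; -_; _+_; _-_; _*_; 0ℤ; 1ℤ)
open import Data.Product using (Σ; ∃; _×_; _,_)
open import Data.Sum using (_⊎_)
open import Relation.Binary.PropositionalEquality using (_≡_)
open import Relation.Nullary using (¬_; yes; no)
open import Function.Bundles using (_⇔_)

-- Two linear lists represent the same cyclic order iff one is a rotation of the other.
CyclicEq : {A : Set} → List A → List A → Set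
CyclicEq {A} l l' = Σ (List A) λ p → Σ (List A) λ q → (l ≡ p ++ q) × (l' ≡ q ++ p)

-- A ribbon graph without loops or multiple edges: vertices Fin V, simple adjacency,
-- connected, and at each vertex a cyclic ordering of incident edges (= neighbours,
-- since the graph is simple), given by a duplicate-free list of the neighbours read
-- up to rotation.
record RibbonGraph : Set where
  field
    V : ℕ
    adj : Fin V → Fin V → Bool
    adj-sym : ∀ u v → adj u v ≡ adj v u
    adj-irrefl : ∀ v → adj v v ≡ false
  E : Fin V → Fin V → Set
  E u v = adj u v ≡ true
  field
    connected : ∀ u v → (u ≡ v) ⊎ (Σ (List (Fin V)) λ ws → Linked E (u ∷ ws ++ v ∷ []))
    rot : Fin V → List (Fin V)
    rot-unique : ∀ v → Unique (rot v)
    rot-nbrs : ∀ v w → (w ∈ rot v) ⇔ E v w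

module _ (G : RibbonGraph) where
  open RibbonGraph G
  open DecMem (_≟_ {V}) using (_∈?_)

  restrict : List (Fin V) → List (Fin V) → List (Fin V)
  restrict S l = filter (λ w → w ∈? S) l

  record TypeII : Set where
    field
      c a₁ aₙ f₁ fₖ : Fin V
      aMid fMid : List (Fin V)
    as : List (Fin V)
    as = a₁ ∷ aMid ++ aₙ ∷ []
    fs : List (Fin V)
    fs = f₁ ∷ fMid ++ fₖ ∷ []
    field
      distinct : Unique (c ∷ as ++ fs)
      cycleA : Linked E (c ∷ as ++ c ∷ [])
      cycleF : Linked E (c ∷ fs ++ c ∷ [])
      order : CyclicEq (restrict (a₁ ∷ fₖ ∷ aₙ ∷ f₁ ∷ []) (rot c)) (a₁ ∷ fₖ ∷ aₙ ∷ f₁ ∷ [])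

  Div : Set
  Div = Fin V → ℤ

  δ : Fin V → Fin V → ℤ
  δ u w with u ≟ w
  ... | yes _ = 1ℤ
  ... | no _ = 0ℤ

  sumℤ : List ℤ → ℤ
  sumℤ = foldr _+_ 0ℤ

  module G1Defs (c : Fin V) (xs : List (Fin V)) where
    -- There is a path c, v₁, …, v_{m-1}, z (listed as c ∷ inner ++ [z]) whose first edge
    -- is c x with x among the xs, which uses c only at its endpoints, whose vertices are
    -- distinct (except that z may equal c), and whose last edge is traversed as u → v.
    G1Arc : Fin V → Fin V → Set
    G1Arc u v = Σ (List (Fin V)) λ inner → Σ (Fin V) λ z → Σ (Fin V) λ x →
      (x ∈ xs) ×
      (Σ (List (Fin V)) λ rest → inner ++ z ∷ [] ≡ x ∷ rest) ×
      Linked E (c ∷ inner ++ z ∷ []) ×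
      (c ∉ inner) ×
      Unique (inner ++ z ∷ []) ×
      (Σ (List (Fin V)) λ pre → c ∷ inner ++ z ∷ [] ≡ pre ++ u ∷ v ∷ [])

    G1Edge : Fin V → Fin V → Set
    G1Edge u v = G1Arc u v ⊎ G1Arc v u

    InG1 : Fin V → Set
    InG1 v = Σ (Fin V) λ u → G1Edge v u

    -- Generator for v ∈ V(G₁): Σ over edges uv of G₁ (oriented into v) of ((v) - (u));
    -- the sum is taken over a duplicate-free enumeration L of the G₁-neighbours of v.
    Gen : Div → Set
    Gen D = Σ (Fin V) λ v → InG1 v × (Σ (List (Fin V)) λ L →
      Unique L × (∀ u → (u ∈ L) ⇔ G1Edge v u) ×
      (∀ w → D w ≡ sumℤ (map (λ u → δ v w - δ u w) L)))

    data Span : Div → Set where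
      span-zero : ∀ D → (∀ w → D w ≡ 0ℤ) → Span D
      span-gen : ∀ D → Gen D → Span D
      span-add : ∀ D D₁ D₂ → Span D₁ → Span D₂ → (∀ w → D w ≡ D₁ w + D₂ w) → Span D
      span-neg : ∀ D D₁ → Span D₁ → (∀ w → D w ≡ - D₁ w) → Span D

    _∼₁_ : Div → Div → Set
    D ∼₁ D' = Span (λ w → D w - D' w)

    zeroDiv : Div
    zeroDiv _ = 0ℤ

    D₀ : Div
    D₀ w = + 2 * sumℤ (map (λ x → δ x w - δ c w) xs)

-- If 2 ∑ᵢ ((xᵢ) − (c)) ∼₁ 0 then it equals Δh, for Δ the Laplacian of G₁ and an integer potential h which we
-- normalise to h(c) = 0. Pair Δh with a level set φ = [h ≥ t], t ≥ 1: the energy ∑_{w,u} A(w,u)(h w − h u)(φ w − φ u)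
-- equals 2 ∑ Δh·φ = 4 #{i : h(xᵢ) ≥ t}, while an edge c u contributes A(c,u) h(u) φ(u) from each side and every other
-- edge crossing the level set at least 1. As ∑ᵤ A(c,u) h(u) = −Δh(c) = 2N, the level t = 1 forces h ≥ 1 at every xᵢ
-- and at its neighbours other than c. At the level t = 2, a G₁-neighbour y of c outside the xᵢ forces h(y) < 2 and
-- leaves no edge of G₁ − c crossing the level set; since y is joined in G₁ − c to some xᵢ = z (for the type II graph,
-- y = f₁ and z = f_k along the second cycle read backwards), h(z) = 1. Then Δh(z) ≤ 1, whereas Δh(z) = 2.

module Submission where

open import Defs
open import Data.Fin using (Fin)
open import Data.List using (List; _∷_; _++_)
open import Data.List.Membership.Propositional using (_∈_)
open import Relation.Nullary using (¬_)

open import Data.Nat using (ℕ; zero; suc; s≤s; z≤n)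
open import Data.Fin using (zero; suc; _≟_; punchIn)
open import Data.Fin.Properties using (punchInᵢ≢i)
open import Data.Integer using (ℤ; +_; -_; _+_; _-_; _*_; 0ℤ; 1ℤ; -1ℤ; _≤_; _<_; _≤?_; +≤+)
import Data.Integer.Properties as ℤ
open import Data.Integer.Tactic.RingSolver using (solve-∀)
open import Algebra.Properties.Semiring.Sum ℤ.+-*-semiring
  using (sum; sum-syntax; sum-cong-≗; sum-remove; sum-replicate-zero; ∑-distrib-+; ∑-comm; *-distribˡ-sum; *-distribʳ-sum)
open import Data.List using ([]; map; foldr; reverse; filter; reverseAcc)
open import Data.List.Properties
  using (++-assoc; ++-identityʳ; ∷-injective; ∷-injectiveˡ; ∷-injectiveʳ; ++-conicalʳ; filter-++; filter-accept; unfold-reverse; reverse-++; map-cong)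
open import Data.List.Relation.Unary.Linked using (Linked; []; [-]; _∷_)
open import Data.List.Relation.Unary.All using (All; []; _∷_)
import Data.List.Relation.Unary.All as All
import Data.List.Relation.Unary.All.Properties as Allₚ
open import Data.List.Relation.Unary.AllPairs using ([]; _∷_)
open import Data.List.Relation.Unary.Any using (here; there)
open import Data.List.Relation.Unary.Unique.Propositional using (Unique)
import Data.List.Relation.Unary.Unique.Propositional.Properties as Uniqueₚ
open import Data.List.Relation.Binary.Disjoint.Propositional using (Disjoint)
open import Data.List.Relation.Binary.Permutation.Setoid using (↭-sym)
open import Data.List.Relation.Binary.Permutation.Setoid.Properties using (Unique-resp-↭; ↭-reverse; ∈-resp-↭)
open import Data.List.Membership.Propositional using (_∉_)
open import Data.List.Membership.Propositional.Properties using (∈-++⁺ˡ; ∈-++⁺ʳ; ∈-++⁻; ∈-filter⁻)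
import Data.List.Membership.DecPropositional as DecMembership
open import Data.Product using (∃; _×_; _,_; proj₁; proj₂)
open import Data.Sum using (_⊎_; inj₁; inj₂)
open import Data.Empty using (⊥; ⊥-elim)
open import Function using (_∘_)
open import Function.Bundles using (Equivalence)
open import Relation.Binary.PropositionalEquality
open import Relation.Nullary using (Dec; yes; no; ¬?; _×-dec_)
open import Relation.Nullary.Decidable using (decidable-stable; ¬¬-excluded-middle)
open import Relation.Unary using (Decidable)

⟦_⟧ : ∀ {P : Set} → Dec P → ℤ
⟦ yes _ ⟧ = 1ℤ
⟦ no _ ⟧ = 0ℤ

⟦⟧-yes : ∀ {P : Set} (P? : Dec P) → P → ⟦ P? ⟧ ≡ 1ℤ
⟦⟧-yes (yes _) _ = refl
⟦⟧-yes (no ¬p) p = ⊥-elim (¬p p)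

⟦⟧-no : ∀ {P : Set} (P? : Dec P) → ¬ P → ⟦ P? ⟧ ≡ 0ℤ
⟦⟧-no (yes p) ¬p = ⊥-elim (¬p p)
⟦⟧-no (no _) _ = refl

⟦⟧-cong : ∀ {P Q : Set} (P? : Dec P) (Q? : Dec Q) → (P → Q) → (Q → P) → ⟦ P? ⟧ ≡ ⟦ Q? ⟧
⟦⟧-cong (yes p) Q? to from = sym (⟦⟧-yes Q? (to p))
⟦⟧-cong (no ¬p) Q? to from = sym (⟦⟧-no Q? (¬p ∘ from))

0≤⟦⟧ : ∀ {P : Set} (P? : Dec P) → 0ℤ ≤ ⟦ P? ⟧
0≤⟦⟧ (yes _) = +≤+ z≤n
0≤⟦⟧ (no _) = ℤ.≤-refl

⟦⟧≤1 : ∀ {P : Set} (P? : Dec P) → ⟦ P? ⟧ ≤ 1ℤ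
⟦⟧≤1 (yes _) = ℤ.≤-refl
⟦⟧≤1 (no _) = +≤+ z≤n

1≤⟦⟧⇒ : ∀ {P : Set} (P? : Dec P) → 1ℤ ≤ ⟦ P? ⟧ → P
1≤⟦⟧⇒ (yes p) _ = p
1≤⟦⟧⇒ (no _) (+≤+ ())

⟦⟧≤0⇒¬ : ∀ {P : Set} (P? : Dec P) → ⟦ P? ⟧ ≤ 0ℤ → ¬ P
⟦⟧≤0⇒¬ (yes _) (+≤+ ())
⟦⟧≤0⇒¬ (no ¬p) _ = ¬p

⟦⟧*-monoʳ-≤ : ∀ {P : Set} (P? : Dec P) {x y : ℤ} → x ≤ y → ⟦ P? ⟧ * x ≤ ⟦ P? ⟧ * y
⟦⟧*-monoʳ-≤ (yes _) {x} {y} x≤y = subst₂ _≤_ (sym (ℤ.*-identityˡ x)) (sym (ℤ.*-identityˡ y)) x≤y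
⟦⟧*-monoʳ-≤ (no _) _ = ℤ.≤-refl

0≤⟦⟧*⟦⟧ : ∀ {P Q : Set} (P? : Dec P) (Q? : Dec Q) → 0ℤ ≤ ⟦ P? ⟧ * ⟦ Q? ⟧
0≤⟦⟧*⟦⟧ P? Q? = ℤ.≤-trans (ℤ.≤-reflexive (sym (ℤ.*-zeroʳ ⟦ P? ⟧))) (⟦⟧*-monoʳ-≤ P? (0≤⟦⟧ Q?))

⟦⟧*-nonpos : ∀ {P : Set} (P? : Dec P) {x : ℤ} → (P → x ≤ 0ℤ) → ⟦ P? ⟧ * x ≤ 0ℤ
⟦⟧*-nonpos (yes p) {x} x≤0 = subst (_≤ 0ℤ) (sym (ℤ.*-identityˡ x)) (x≤0 p)
⟦⟧*-nonpos (no _) _ = ℤ.≤-refl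

*-distribˡ-- : ∀ a b c → a * (b - c) ≡ a * b - a * c
*-distribˡ-- a b c = trans (ℤ.*-distribˡ-+ a b (- c)) (cong (_+_ (a * b)) (sym (ℤ.neg-distribʳ-* a c)))

∑-neg : ∀ {n} (f : Fin n → ℤ) → ∑[ i < n ] (- f i) ≡ - sum f
∑-neg {n} f = begin
  ∑[ i < n ] (- f i)        ≡⟨ sum-cong-≗ (λ i → sym (ℤ.-1*i≡-i (f i))) ⟩
  ∑[ i < n ] (-1ℤ * f i)    ≡⟨ sym (*-distribˡ-sum -1ℤ f) ⟩
  -1ℤ * sum f               ≡⟨ ℤ.-1*i≡-i (sum f) ⟩
  - sum f                   ∎
  where open ≡-Reasoning

∑-distrib-- : ∀ {n} (f g : Fin n → ℤ) → ∑[ i < n ] (f i - g i) ≡ sum f - sum g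
∑-distrib-- {n} f g = begin
  ∑[ i < n ] (f i - g i)              ≡⟨ ∑-distrib-+ f (λ i → - g i) ⟩
  sum f + ∑[ i < n ] (- g i)          ≡⟨ cong (_+_ (sum f)) (∑-neg g) ⟩
  sum f - sum g                       ∎
  where open ≡-Reasoning

∑-mono-≤ : ∀ {n} {f g : Fin n → ℤ} → (∀ i → f i ≤ g i) → sum f ≤ sum g
∑-mono-≤ {zero} _ = ℤ.≤-refl
∑-mono-≤ {suc n} f≤g = ℤ.+-mono-≤ (f≤g zero) (∑-mono-≤ (f≤g ∘ suc))

∑-nonneg : ∀ {n} {f : Fin n → ℤ} → (∀ i → 0ℤ ≤ f i) → 0ℤ ≤ sum f
∑-nonneg {n} 0≤f = ℤ.≤-trans (ℤ.≤-reflexive (sym (sum-replicate-zero n))) (∑-mono-≤ 0≤f)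

∑-⟦≟⟧ : ∀ {n} (f : Fin n → ℤ) (w : Fin n) → ∑[ u < n ] (⟦ w ≟ u ⟧ * f u) ≡ f w
∑-⟦≟⟧ {suc m} f w = begin
  ∑[ u < suc m ] (⟦ w ≟ u ⟧ * f u)                                 ≡⟨ sum-remove {i = w} (λ u → ⟦ w ≟ u ⟧ * f u) ⟩
  ⟦ w ≟ w ⟧ * f w + ∑[ j < m ] (⟦ w ≟ punchIn w j ⟧ * f (punchIn w j))
    ≡⟨ cong₂ _+_ (cong (_* f w) (⟦⟧-yes (w ≟ w) refl)) (sum-cong-≗ off-w) ⟩
  1ℤ * f w + ∑[ j < m ] 0ℤ                                          ≡⟨ cong₂ _+_ (ℤ.*-identityˡ (f w)) (sum-replicate-zero m) ⟩
  f w + 0ℤ                                                          ≡⟨ ℤ.+-identityʳ (f w) ⟩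
  f w                                                               ∎
  where
  open ≡-Reasoning
  off-w : ∀ j → ⟦ w ≟ punchIn w j ⟧ * f (punchIn w j) ≡ 0ℤ
  off-w j = cong (_* f (punchIn w j)) (⟦⟧-no (w ≟ punchIn w j) (punchInᵢ≢i w j ∘ sym))

f≤∑ : ∀ {n} {f : Fin n → ℤ} → (∀ i → 0ℤ ≤ f i) → ∀ k → f k ≤ sum f
f≤∑ {suc n} {f} 0≤f k = begin
  f k                               ≡⟨ ℤ.+-identityʳ (f k) ⟨
  f k + 0ℤ                          ≤⟨ ℤ.+-monoʳ-≤ (f k) (∑-nonneg (0≤f ∘ punchIn k)) ⟩
  f k + ∑[ j < n ] f (punchIn k j)  ≡⟨ sum-remove {i = k} f ⟨
  sum f                             ∎
  where open ℤ.≤-Reasoning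

i<j⇒1≤j-i : ∀ {i j} → i < j → 1ℤ ≤ j - i
i<j⇒1≤j-i {i} {j} i<j = begin
  1ℤ             ≡⟨ suc-i≡1 i ⟨
  (1ℤ + i) - i   ≤⟨ ℤ.+-monoˡ-≤ (- i) (ℤ.i<j⇒suc[i]≤j i<j) ⟩
  j - i          ∎
  where
  open ℤ.≤-Reasoning
  suc-i≡1 : ∀ i → (1ℤ + i) - i ≡ 1ℤ
  suc-i≡1 = solve-∀

⟦≢⟧≤[i-j]*[⟦t≤i⟧-⟦t≤j⟧] : ∀ t a b →
  ⟦ ¬? (⟦ t ≤? a ⟧ ℤ.≟ ⟦ t ≤? b ⟧) ⟧ ≤ (a - b) * (⟦ t ≤? a ⟧ - ⟦ t ≤? b ⟧)
⟦≢⟧≤[i-j]*[⟦t≤i⟧-⟦t≤j⟧] t a b with t ≤? a | t ≤? b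
... | yes _ | yes _ = ℤ.≤-reflexive (sym (ℤ.*-zeroʳ (a - b)))
... | no _ | no _ = ℤ.≤-reflexive (sym (ℤ.*-zeroʳ (a - b)))
... | yes t≤a | no t≰b = ℤ.≤-trans (i<j⇒1≤j-i (ℤ.<-≤-trans (ℤ.≰⇒> t≰b) t≤a)) (ℤ.≤-reflexive (sym (ℤ.*-identityʳ (a - b))))
... | no t≰a | yes t≤b = ℤ.≤-trans (i<j⇒1≤j-i (ℤ.<-≤-trans (ℤ.≰⇒> t≰a) t≤b)) (ℤ.≤-reflexive (flip a b))
  where
  flip : ∀ a b → b - a ≡ (a - b) * (0ℤ - 1ℤ)
  flip = solve-∀

i≤i*⟦1≤i⟧ : ∀ a → a ≤ a * ⟦ 1ℤ ≤? a ⟧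
i≤i*⟦1≤i⟧ a with 1ℤ ≤? a
... | yes _ = ℤ.≤-reflexive (sym (ℤ.*-identityʳ a))
... | no 1≰a = ℤ.≤-trans (ℤ.i<j⇒i≤pred[j] (ℤ.≰⇒> 1≰a)) (ℤ.≤-reflexive (sym (ℤ.*-zeroʳ a)))

t*⟦t≤i⟧≤i*⟦t≤i⟧ : ∀ t a → t * ⟦ t ≤? a ⟧ ≤ a * ⟦ t ≤? a ⟧
t*⟦t≤i⟧≤i*⟦t≤i⟧ t a with t ≤? a
... | yes t≤a = ℤ.*-monoʳ-≤-nonNeg 1ℤ t≤a
... | no _ = ℤ.≤-reflexive (trans (ℤ.*-zeroʳ t) (sym (ℤ.*-zeroʳ a)))

i+j≤i⇒j≤0 : ∀ {i j} → i + j ≤ i → j ≤ 0ℤ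
i+j≤i⇒j≤0 {i} {j} i+j≤i = begin
  j              ≡⟨ cancel i j ⟨
  (i + j) - i    ≤⟨ ℤ.+-monoˡ-≤ (- i) i+j≤i ⟩
  i - i          ≡⟨ ℤ.+-inverseʳ i ⟩
  0ℤ             ∎
  where
  open ℤ.≤-Reasoning
  cancel : ∀ i j → (i + j) - i ≡ j
  cancel = solve-∀

module _ {n : ℕ} (A : Fin n → Fin n → ℤ) where

  Δ : (Fin n → ℤ) → Fin n → ℤ
  Δ h w = ∑[ u < n ] (A w u * (h w - h u))

  Δ-+ : ∀ g h w → Δ (λ x → g x + h x) w ≡ Δ g w + Δ h w
  Δ-+ g h w = trans (sum-cong-≗ (λ u → distrib (A w u) (g w) (g u) (h w) (h u)))
                    (∑-distrib-+ (λ u → A w u * (g w - g u)) (λ u → A w u * (h w - h u)))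
    where
    distrib : ∀ a p q s t → a * ((p + s) - (q + t)) ≡ a * (p - q) + a * (s - t)
    distrib = solve-∀

  Δ-neg : ∀ h w → Δ (λ x → - h x) w ≡ - Δ h w
  Δ-neg h w = trans (sum-cong-≗ (λ u → negate (A w u) (h w) (h u))) (∑-neg (λ u → A w u * (h w - h u)))
    where
    negate : ∀ a p q → a * (- p - - q) ≡ - (a * (p - q))
    negate = solve-∀

  Δ-const : ∀ k w → Δ (λ _ → k) w ≡ 0ℤ
  Δ-const k w = trans (sum-cong-≗ (λ u → trans (cong (A w u *_) (ℤ.+-inverseʳ k)) (ℤ.*-zeroʳ (A w u))))
                      (sum-replicate-zero n)

  module _ (A-sym : ∀ u v → A u v ≡ A v u) where

    Δ-⟦≟⟧ : ∀ v w → Δ (λ u → ⟦ v ≟ u ⟧) w ≡ ∑[ u < n ] (A v u * (⟦ v ≟ w ⟧ - ⟦ u ≟ w ⟧))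
    Δ-⟦≟⟧ v w with v ≟ w
    ... | yes refl = sum-cong-≗ (λ u → cong (λ d → A v u * (1ℤ - d)) (⟦⟧-cong (v ≟ u) (u ≟ v) sym sym))
    ... | no _ = begin
      ∑[ u < n ] (A w u * (0ℤ - ⟦ v ≟ u ⟧))  ≡⟨ ∑-A*-⟦≟⟧ w v ⟩
      - A w v                              ≡⟨ cong -_ (A-sym w v) ⟩
      - A v w                              ≡⟨ ∑-A*-⟦≟⟧ v w ⟨
      ∑[ u < n ] (A v u * (0ℤ - ⟦ w ≟ u ⟧))  ≡⟨ sum-cong-≗ (λ u → cong (λ d → A v u * (0ℤ - d)) (⟦⟧-cong (w ≟ u) (u ≟ w) sym sym)) ⟩
      ∑[ u < n ] (A v u * (0ℤ - ⟦ u ≟ w ⟧))  ∎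
      where
      open ≡-Reasoning
      ∑-A*-⟦≟⟧ : ∀ x y → ∑[ u < n ] (A x u * (0ℤ - ⟦ y ≟ u ⟧)) ≡ - A x y
      ∑-A*-⟦≟⟧ x y = begin
        ∑[ u < n ] (A x u * (0ℤ - ⟦ y ≟ u ⟧))  ≡⟨ sum-cong-≗ (λ u → swap (A x u) ⟦ y ≟ u ⟧) ⟩
        ∑[ u < n ] (- (⟦ y ≟ u ⟧ * A x u))     ≡⟨ ∑-neg (λ u → ⟦ y ≟ u ⟧ * A x u) ⟩
        - ∑[ u < n ] (⟦ y ≟ u ⟧ * A x u)       ≡⟨ cong -_ (∑-⟦≟⟧ (A x) y) ⟩
        - A x y                              ∎
        where
        swap : ∀ a d → a * (0ℤ - d) ≡ - (d * a)
        swap = solve-∀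

    Δ-energy : ∀ (h φ : Fin n → ℤ) → ∑[ w < n ] ∑[ u < n ] (A w u * (h w - h u) * (φ w - φ u)) ≡ + 2 * ∑[ w < n ] (Δ h w * φ w)
    Δ-energy h φ = begin
      ∑[ w < n ] ∑[ u < n ] (A w u * (h w - h u) * (φ w - φ u))
        ≡⟨ sum-cong-≗ (λ w → trans (sum-cong-≗ (λ u → *-distribˡ-- (A w u * (h w - h u)) (φ w) (φ u))) (∑-distrib-- (F w) (G w))) ⟩
      ∑[ w < n ] (∑[ u < n ] F w u - ∑[ u < n ] G w u)
        ≡⟨ ∑-distrib-- (λ w → sum (F w)) (λ w → sum (G w)) ⟩
      ∑[ w < n ] ∑[ u < n ] F w u - ∑[ w < n ] ∑[ u < n ] G w u
        ≡⟨ cong₂ _-_ ∑∑F≡X ∑∑G≡-X ⟩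
      X - - X
        ≡⟨ twice X ⟩
      + 2 * X ∎
      where
      open ≡-Reasoning
      F G : Fin n → Fin n → ℤ
      F w u = A w u * (h w - h u) * φ w
      G w u = A w u * (h w - h u) * φ u
      X : ℤ
      X = ∑[ w < n ] (Δ h w * φ w)
      twice : ∀ x → x - - x ≡ + 2 * x
      twice = solve-∀
      antisym : ∀ a p q f → a * (p - q) * f ≡ - (a * (q - p) * f)
      antisym = solve-∀
      ∑∑F≡X : ∑[ w < n ] ∑[ u < n ] F w u ≡ X
      ∑∑F≡X = sum-cong-≗ (λ w → sym (*-distribʳ-sum (φ w) (λ u → A w u * (h w - h u))))
      ∑∑G≡-X : ∑[ w < n ] ∑[ u < n ] G w u ≡ - X
      ∑∑G≡-X = begin
        ∑[ w < n ] ∑[ u < n ] G w u                ≡⟨ ∑-comm G ⟩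
        ∑[ u < n ] ∑[ w < n ] G w u                ≡⟨ sum-cong-≗ (λ u → sum-cong-≗ (λ w →
                                                       trans (cong (λ a → a * (h w - h u) * φ u) (A-sym w u)) (antisym (A u w) (h w) (h u) (φ u)))) ⟩
        ∑[ u < n ] ∑[ w < n ] (- F u w)            ≡⟨ sum-cong-≗ (λ u → ∑-neg (F u)) ⟩
        ∑[ u < n ] (- ∑[ w < n ] F u w)            ≡⟨ ∑-neg (λ u → sum (F u)) ⟩
        - ∑[ u < n ] ∑[ w < n ] F u w              ≡⟨ cong -_ ∑∑F≡X ⟩
        - X                                        ∎

module _ {n : ℕ} (c : Fin n) {S : Fin n → Set} (S? : ∀ u → Dec (S u)) where

  twiceStar : Fin n → ℤ
  twiceStar w = + 2 * (⟦ S? w ⟧ - sum (λ u → ⟦ S? u ⟧) * ⟦ c ≟ w ⟧)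

  ∑-twiceStar* : ∀ (φ : Fin n → ℤ) → φ c ≡ 0ℤ → ∑[ w < n ] (twiceStar w * φ w) ≡ + 2 * ∑[ w < n ] (⟦ S? w ⟧ * φ w)
  ∑-twiceStar* φ φ[c]≡0 = trans (sum-cong-≗ term) (sym (*-distribˡ-sum (+ 2) (λ w → ⟦ S? w ⟧ * φ w)))
    where
    N : ℤ
    N = sum (λ u → ⟦ S? u ⟧)
    ⟦c≟w⟧*φ[w]≡0 : ∀ w → ⟦ c ≟ w ⟧ * φ w ≡ 0ℤ
    ⟦c≟w⟧*φ[w]≡0 w with c ≟ w
    ... | yes refl = trans (ℤ.*-identityˡ (φ c)) φ[c]≡0
    ... | no _ = refl
    expand : ∀ s N d f → + 2 * (s - N * d) * f ≡ + 2 * (s * f) - + 2 * N * (d * f)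
    expand = solve-∀
    term : ∀ w → twiceStar w * φ w ≡ + 2 * (⟦ S? w ⟧ * φ w)
    term w = begin
      twiceStar w * φ w                                                ≡⟨ expand ⟦ S? w ⟧ N ⟦ c ≟ w ⟧ (φ w) ⟩
      + 2 * (⟦ S? w ⟧ * φ w) - + 2 * N * (⟦ c ≟ w ⟧ * φ w)              ≡⟨ cong (λ x → + 2 * (⟦ S? w ⟧ * φ w) - + 2 * N * x) (⟦c≟w⟧*φ[w]≡0 w) ⟩
      + 2 * (⟦ S? w ⟧ * φ w) - + 2 * N * 0ℤ                            ≡⟨ cong (λ x → + 2 * (⟦ S? w ⟧ * φ w) - x) (ℤ.*-zeroʳ (+ 2 * N)) ⟩
      + 2 * (⟦ S? w ⟧ * φ w) - 0ℤ                                      ≡⟨ ℤ.+-identityʳ (+ 2 * (⟦ S? w ⟧ * φ w)) ⟩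
      + 2 * (⟦ S? w ⟧ * φ w)                                           ∎
      where open ≡-Reasoning

module Avoiding {n : ℕ} (_~_ : Fin n → Fin n → Set) (c : Fin n) where

  _~ᶜ_ : Fin n → Fin n → Set
  w ~ᶜ u = ¬ w ≡ c × ¬ u ≡ c × w ~ u

  -- Weak form of "z and y are joined by a path in G − c": no function constant along its edges separates them.
  Joinedᶜ : Fin n → Fin n → Set
  Joinedᶜ z y = ∀ (φ : Fin n → ℤ) → (∀ {w u} → w ~ᶜ u → φ w ≡ φ u) → φ z ≡ φ y

module _ {n : ℕ} {_~_ : Fin n → Fin n → Set} (_~?_ : ∀ u v → Dec (u ~ v)) where

  adjacency : Fin n → Fin n → ℤ
  adjacency u v = ⟦ u ~? v ⟧

  adjacency-sym : (∀ {u v} → u ~ v → v ~ u) → ∀ u v → adjacency u v ≡ adjacency v u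
  adjacency-sym ~-sym u v = ⟦⟧-cong (u ~? v) (v ~? u) ~-sym ~-sym

  module _ (~-sym : ∀ {u v} → u ~ v → v ~ u) (~-irrefl : ∀ {v} → ¬ v ~ v)
           (c : Fin n) {S : Fin n → Set} (S? : ∀ u → Dec (S u)) (S⊆N[c] : ∀ {x} → S x → c ~ x) where

    ¬S[c] : ¬ S c
    ¬S[c] Sc = ~-irrefl (S⊆N[c] Sc)

    open Avoiding _~_ c

    adjacencyᶜ : Fin n → Fin n → ℤ
    adjacencyᶜ w u = ⟦ ¬? (w ≟ c) ×-dec ¬? (u ≟ c) ×-dec (w ~? u) ⟧

    adjacencyᶜ-from-c : ∀ u → adjacencyᶜ c u ≡ 0ℤ
    adjacencyᶜ-from-c u = ⟦⟧-no (¬? (c ≟ c) ×-dec ¬? (u ≟ c) ×-dec (c ~? u)) (λ (c≢c , _) → c≢c refl)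

    adjacencyᶜ-to-c : ∀ w → adjacencyᶜ w c ≡ 0ℤ
    adjacencyᶜ-to-c w = ⟦⟧-no (¬? (w ≟ c) ×-dec ¬? (c ≟ c) ×-dec (w ~? c)) (λ (_ , c≢c , _) → c≢c refl)

    adjacencyᶜ-off-c : ∀ {w u} → ¬ w ≡ c → ¬ u ≡ c → adjacencyᶜ w u ≡ adjacency w u
    adjacencyᶜ-off-c {w} {u} w≢c u≢c =
      ⟦⟧-cong (¬? (w ≟ c) ×-dec ¬? (u ≟ c) ×-dec (w ~? u)) (w ~? u) (proj₂ ∘ proj₂) (λ w~u → w≢c , u≢c , w~u)

    module Levels (h : Fin n → ℤ) (h[c]≡0 : h c ≡ 0ℤ) (Δh≡twiceStar : ∀ w → Δ adjacency h w ≡ twiceStar c S? w) where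

      level : ℤ → Fin n → ℤ
      level t w = ⟦ t ≤? h w ⟧

      crossing : ℤ → Fin n → Fin n → ℤ
      crossing t w u = ⟦ ¬? (level t w ℤ.≟ level t u) ⟧

      flux : ℤ → ℤ
      flux t = ∑[ u < n ] (adjacency c u * (h u * level t u))

      cut : ℤ → ℤ
      cut t = ∑[ w < n ] ∑[ u < n ] (adjacencyᶜ w u * crossing t w u)

      mass : ℤ → ℤ
      mass t = ∑[ u < n ] (⟦ S? u ⟧ * level t u)

      0≤cut-term : ∀ t w u → 0ℤ ≤ adjacencyᶜ w u * crossing t w u
      0≤cut-term t w u = 0≤⟦⟧*⟦⟧ (¬? (w ≟ c) ×-dec ¬? (u ≟ c) ×-dec (w ~? u)) (¬? (level t w ℤ.≟ level t u))

      cut-nonneg : ∀ t → 0ℤ ≤ cut t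
      cut-nonneg t = ∑-nonneg (λ w → ∑-nonneg (0≤cut-term t w))

      cut≤0⇒level-invariant : ∀ {t} → cut t ≤ 0ℤ → ∀ {w u} → w ~ᶜ u → level t w ≡ level t u
      cut≤0⇒level-invariant {t} cut≤0 {w} {u} (w≢c , u≢c , w~u) =
        decidable-stable (level t w ℤ.≟ level t u) (⟦⟧≤0⇒¬ (¬? (level t w ℤ.≟ level t u)) (begin
          crossing t w u                                ≡⟨ ℤ.*-identityˡ (crossing t w u) ⟨
          1ℤ * crossing t w u                           ≡⟨ cong (_* crossing t w u) (trans (adjacencyᶜ-off-c w≢c u≢c) (⟦⟧-yes (w ~? u) w~u)) ⟨
          adjacencyᶜ w u * crossing t w u               ≤⟨ f≤∑ (0≤cut-term t w) u ⟩
          ∑[ v < n ] (adjacencyᶜ w v * crossing t w v)  ≤⟨ f≤∑ (λ x → ∑-nonneg (0≤cut-term t x)) w ⟩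
          cut t                                         ≤⟨ cut≤0 ⟩
          0ℤ                                            ∎))
        where open ℤ.≤-Reasoning

      module _ {t : ℤ} (1≤t : 1ℤ ≤ t) where

        level[c]≡0 : level t c ≡ 0ℤ
        level[c]≡0 = ⟦⟧-no (t ≤? h c) (λ t≤h[c] → 1≰0 (ℤ.≤-trans 1≤t (subst (_≤_ t) h[c]≡0 t≤h[c])))
          where
          1≰0 : ¬ 1ℤ ≤ 0ℤ
          1≰0 (+≤+ ())

        private
          flux-at : Fin n → ℤ
          flux-at u = adjacency c u * (h u * level t u)

          energy-at : Fin n → Fin n → ℤ
          energy-at w u = adjacency w u * (h w - h u) * (level t w - level t u)

          -- As h and the level set vanish at c, an edge at c contributes `flux-at` of its other end;
          -- any other edge crossing the level set contributes at least 1.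
          energy-lower-at : Fin n → Fin n → ℤ
          energy-lower-at w u = ⟦ c ≟ w ⟧ * flux-at u + ⟦ c ≟ u ⟧ * flux-at w + adjacencyᶜ w u * crossing t w u

          flux-at[c]≡0 : flux-at c ≡ 0ℤ
          flux-at[c]≡0 = cong (_* (h c * level t c)) (⟦⟧-no (c ~? c) ~-irrefl)

          energy-from-c : ∀ u → energy-at c u ≡ flux-at u
          energy-from-c u = begin
            adjacency c u * (h c - h u) * (level t c - level t u)
              ≡⟨ cong₂ (λ x y → adjacency c u * (x - h u) * (y - level t u)) h[c]≡0 level[c]≡0 ⟩
            adjacency c u * (0ℤ - h u) * (0ℤ - level t u)
              ≡⟨ neg*neg (adjacency c u) (h u) (level t u) ⟩
            flux-at u ∎
            where
            open ≡-Reasoning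
            neg*neg : ∀ a x y → a * (0ℤ - x) * (0ℤ - y) ≡ a * (x * y)
            neg*neg = solve-∀

          energy-to-c : ∀ w → energy-at w c ≡ flux-at w
          energy-to-c w = begin
            adjacency w c * (h w - h c) * (level t w - level t c)
              ≡⟨ cong₂ (λ x y → adjacency w c * (h w - x) * (level t w - y)) h[c]≡0 level[c]≡0 ⟩
            adjacency w c * (h w - 0ℤ) * (level t w - 0ℤ)
              ≡⟨ cong (λ a → a * (h w - 0ℤ) * (level t w - 0ℤ)) (adjacency-sym ~-sym w c) ⟩
            adjacency c w * (h w - 0ℤ) * (level t w - 0ℤ)
              ≡⟨ pos*pos (adjacency c w) (h w) (level t w) ⟩
            flux-at w ∎
            where
            open ≡-Reasoning
            pos*pos : ∀ a x y → a * (x - 0ℤ) * (y - 0ℤ) ≡ a * (x * y)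
            pos*pos = solve-∀

          energy-lower≤energy : ∀ w u → energy-lower-at w u ≤ energy-at w u
          energy-lower≤energy w u with c ≟ w
          ... | yes refl = ℤ.≤-reflexive (begin
            1ℤ * flux-at u + ⟦ c ≟ u ⟧ * flux-at c + adjacencyᶜ c u * crossing t c u
              ≡⟨ cong₂ (λ x y → 1ℤ * flux-at u + ⟦ c ≟ u ⟧ * x + y * crossing t c u) flux-at[c]≡0 (adjacencyᶜ-from-c u) ⟩
            1ℤ * flux-at u + ⟦ c ≟ u ⟧ * 0ℤ + 0ℤ   ≡⟨ only-first (flux-at u) ⟦ c ≟ u ⟧ ⟩
            flux-at u                             ≡⟨ energy-from-c u ⟨
            energy-at c u                         ∎)
            where
            open ≡-Reasoning
            only-first : ∀ x d → 1ℤ * x + d * 0ℤ + 0ℤ ≡ x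
            only-first = solve-∀
          ... | no c≢w with c ≟ u
          ...   | yes refl = ℤ.≤-reflexive (begin
            0ℤ + 1ℤ * flux-at w + adjacencyᶜ w c * crossing t w c
              ≡⟨ cong (λ y → 0ℤ + 1ℤ * flux-at w + y * crossing t w c) (adjacencyᶜ-to-c w) ⟩
            0ℤ + 1ℤ * flux-at w + 0ℤ   ≡⟨ only-second (flux-at w) ⟩
            flux-at w                 ≡⟨ energy-to-c w ⟨
            energy-at w c             ∎)
            where
            open ≡-Reasoning
            only-second : ∀ x → 0ℤ + 1ℤ * x + 0ℤ ≡ x
            only-second = solve-∀
          ...   | no c≢u = begin
            0ℤ + 0ℤ + adjacencyᶜ w u * crossing t w u    ≡⟨ ℤ.+-identityˡ _ ⟩
            adjacencyᶜ w u * crossing t w u              ≡⟨ cong (_* crossing t w u) (adjacencyᶜ-off-c (c≢w ∘ sym) (c≢u ∘ sym)) ⟩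
            adjacency w u * crossing t w u               ≤⟨ ⟦⟧*-monoʳ-≤ (w ~? u) (⟦≢⟧≤[i-j]*[⟦t≤i⟧-⟦t≤j⟧] t (h w) (h u)) ⟩
            adjacency w u * ((h w - h u) * (level t w - level t u))
                                                         ≡⟨ ℤ.*-assoc (adjacency w u) (h w - h u) (level t w - level t u) ⟨
            energy-at w u                                ∎
            where open ℤ.≤-Reasoning

          ∑∑energy-lower : ∑[ w < n ] ∑[ u < n ] energy-lower-at w u ≡ + 2 * flux t + cut t
          ∑∑energy-lower = begin
            ∑[ w < n ] ∑[ u < n ] energy-lower-at w u
              ≡⟨ sum-cong-≗ (λ w → ∑-distrib-+ (λ u → ⟦ c ≟ w ⟧ * flux-at u + ⟦ c ≟ u ⟧ * flux-at w)
                                                (λ u → adjacencyᶜ w u * crossing t w u)) ⟩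
            ∑[ w < n ] (∑[ u < n ] (⟦ c ≟ w ⟧ * flux-at u + ⟦ c ≟ u ⟧ * flux-at w) + ∑[ u < n ] (adjacencyᶜ w u * crossing t w u))
              ≡⟨ ∑-distrib-+ (λ w → ∑[ u < n ] (⟦ c ≟ w ⟧ * flux-at u + ⟦ c ≟ u ⟧ * flux-at w))
                             (λ w → ∑[ u < n ] (adjacencyᶜ w u * crossing t w u)) ⟩
            ∑[ w < n ] ∑[ u < n ] (⟦ c ≟ w ⟧ * flux-at u + ⟦ c ≟ u ⟧ * flux-at w) + cut t
              ≡⟨ cong (_+ cut t) (sum-cong-≗ row) ⟩
            ∑[ w < n ] (⟦ c ≟ w ⟧ * flux t + flux-at w) + cut t
              ≡⟨ cong (_+ cut t) (trans (∑-distrib-+ (λ w → ⟦ c ≟ w ⟧ * flux t) flux-at) (cong (_+ flux t) (∑-⟦≟⟧ (λ _ → flux t) c))) ⟩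
            flux t + flux t + cut t
              ≡⟨ cong (_+ cut t) (twice (flux t)) ⟩
            + 2 * flux t + cut t ∎
            where
            open ≡-Reasoning
            row : ∀ w → ∑[ u < n ] (⟦ c ≟ w ⟧ * flux-at u + ⟦ c ≟ u ⟧ * flux-at w) ≡ ⟦ c ≟ w ⟧ * flux t + flux-at w
            row w = trans (∑-distrib-+ (λ u → ⟦ c ≟ w ⟧ * flux-at u) (λ u → ⟦ c ≟ u ⟧ * flux-at w))
                          (cong₂ _+_ (sym (*-distribˡ-sum ⟦ c ≟ w ⟧ flux-at)) (∑-⟦≟⟧ (λ _ → flux-at w) c))
            twice : ∀ x → x + x ≡ + 2 * x
            twice = solve-∀

        energy-bound : + 2 * flux t + cut t ≤ + 4 * mass t
        energy-bound = begin
          + 2 * flux t + cut t                              ≡⟨ ∑∑energy-lower ⟨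
          ∑[ w < n ] ∑[ u < n ] energy-lower-at w u           ≤⟨ ∑-mono-≤ (λ w → ∑-mono-≤ (energy-lower≤energy w)) ⟩
          ∑[ w < n ] ∑[ u < n ] energy-at w u                 ≡⟨ Δ-energy adjacency (adjacency-sym ~-sym) h (level t) ⟩
          + 2 * ∑[ w < n ] (Δ adjacency h w * level t w)     ≡⟨ cong (+ 2 *_) (sum-cong-≗ (λ w → cong (_* level t w) (Δh≡twiceStar w))) ⟩
          + 2 * ∑[ w < n ] (twiceStar c S? w * level t w)    ≡⟨ cong (+ 2 *_) (∑-twiceStar* c S? (level t) level[c]≡0) ⟩
          + 2 * (+ 2 * mass t)                              ≡⟨ ℤ.*-assoc (+ 2) (+ 2) (mass t) ⟨
          + 4 * mass t                                      ∎
          where open ℤ.≤-Reasoning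

      N : ℤ
      N = sum (λ u → ⟦ S? u ⟧)

      ∑-adjacency[c]*h : ∑[ u < n ] (adjacency c u * h u) ≡ + 2 * N
      ∑-adjacency[c]*h = begin
        ∑[ u < n ] (adjacency c u * h u)             ≡⟨ ℤ.neg-involutive _ ⟨
        - - ∑[ u < n ] (adjacency c u * h u)         ≡⟨ cong -_ (∑-neg (λ u → adjacency c u * h u)) ⟨
        - ∑[ u < n ] (- (adjacency c u * h u))       ≡⟨ cong -_ (sum-cong-≗ (λ u → trans (neg-as-Δ (adjacency c u) (h u))
                                                                                        (cong (λ x → adjacency c u * (x - h u)) (sym h[c]≡0)))) ⟩
        - Δ adjacency h c                            ≡⟨ cong -_ (Δh≡twiceStar c) ⟩
        - twiceStar c S? c                           ≡⟨ cong₂ (λ x y → - (+ 2 * (x - N * y))) (⟦⟧-no (S? c) ¬S[c]) (⟦⟧-yes (c ≟ c) refl) ⟩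
        - (+ 2 * (0ℤ - N * 1ℤ))                      ≡⟨ simplify N ⟩
        + 2 * N                                      ∎
        where
        open ≡-Reasoning
        neg-as-Δ : ∀ a x → - (a * x) ≡ a * (0ℤ - x)
        neg-as-Δ = solve-∀
        simplify : ∀ N → - (+ 2 * (0ℤ - N * 1ℤ)) ≡ + 2 * N
        simplify = solve-∀

      level-one : cut 1ℤ ≤ 0ℤ × N ≤ mass 1ℤ
      level-one = i+j≤i⇒j≤0 (ℤ.≤-trans 4N+cut≤4mass (ℤ.*-monoˡ-≤-nonNeg (+ 4) mass≤N))
                , ℤ.*-cancelˡ-≤-pos N (mass 1ℤ) (+ 4) (ℤ.≤-trans 4N≤4N+cut 4N+cut≤4mass)
        where
        open ℤ.≤-Reasoning
        mass≤N : mass 1ℤ ≤ N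
        mass≤N = ∑-mono-≤ (λ u → ℤ.≤-trans (⟦⟧*-monoʳ-≤ (S? u) (⟦⟧≤1 (1ℤ ≤? h u))) (ℤ.≤-reflexive (ℤ.*-identityʳ ⟦ S? u ⟧)))
        4N≤4N+cut : + 4 * N ≤ + 4 * N + cut 1ℤ
        4N≤4N+cut = begin
          + 4 * N            ≡⟨ ℤ.+-identityʳ (+ 4 * N) ⟨
          + 4 * N + 0ℤ       ≤⟨ ℤ.+-monoʳ-≤ (+ 4 * N) (cut-nonneg 1ℤ) ⟩
          + 4 * N + cut 1ℤ   ∎
        4N+cut≤4mass : + 4 * N + cut 1ℤ ≤ + 4 * mass 1ℤ
        4N+cut≤4mass = begin
          + 4 * N + cut 1ℤ                                  ≡⟨ cong (_+ cut 1ℤ) (ℤ.*-assoc (+ 2) (+ 2) N) ⟩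
          + 2 * (+ 2 * N) + cut 1ℤ                          ≡⟨ cong (λ x → + 2 * x + cut 1ℤ) ∑-adjacency[c]*h ⟨
          + 2 * ∑[ u < n ] (adjacency c u * h u) + cut 1ℤ    ≤⟨ ℤ.+-monoˡ-≤ (cut 1ℤ) (ℤ.*-monoˡ-≤-nonNeg (+ 2)
                                                                 (∑-mono-≤ (λ u → ⟦⟧*-monoʳ-≤ (c ~? u) (i≤i*⟦1≤i⟧ (h u))))) ⟩
          + 2 * flux 1ℤ + cut 1ℤ                            ≤⟨ energy-bound ℤ.≤-refl ⟩
          + 4 * mass 1ℤ                                     ∎

      S⇒1≤h : ∀ {x} → S x → 1ℤ ≤ h x
      S⇒1≤h {x} Sx = 1≤⟦⟧⇒ (1ℤ ≤? h x) (ℤ.i-j≤0⇒i≤j (begin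
        1ℤ - level 1ℤ x                                 ≡⟨ ℤ.*-identityˡ (1ℤ - level 1ℤ x) ⟨
        1ℤ * (1ℤ - level 1ℤ x)                          ≡⟨ cong (_* (1ℤ - level 1ℤ x)) (⟦⟧-yes (S? x) Sx) ⟨
        ⟦ S? x ⟧ * (1ℤ - level 1ℤ x)                     ≤⟨ f≤∑ deficit-nonneg x ⟩
        ∑[ u < n ] (⟦ S? u ⟧ * (1ℤ - level 1ℤ u))        ≡⟨ sum-cong-≗ (λ u → trans (*-distribˡ-- ⟦ S? u ⟧ 1ℤ (level 1ℤ u))
                                                                              (cong (_- ⟦ S? u ⟧ * level 1ℤ u) (ℤ.*-identityʳ ⟦ S? u ⟧))) ⟩
        ∑[ u < n ] (⟦ S? u ⟧ - ⟦ S? u ⟧ * level 1ℤ u)     ≡⟨ ∑-distrib-- (λ u → ⟦ S? u ⟧) (λ u → ⟦ S? u ⟧ * level 1ℤ u) ⟩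
        N - mass 1ℤ                                     ≤⟨ ℤ.i≤j⇒i-j≤0 (proj₂ level-one) ⟩
        0ℤ                                              ∎))
        where
        open ℤ.≤-Reasoning
        deficit-nonneg : ∀ u → 0ℤ ≤ ⟦ S? u ⟧ * (1ℤ - level 1ℤ u)
        deficit-nonneg u = ℤ.≤-trans (ℤ.≤-reflexive (sym (ℤ.*-zeroʳ ⟦ S? u ⟧)))
                                     (⟦⟧*-monoʳ-≤ (S? u) (ℤ.i≤j⇒0≤j-i (⟦⟧≤1 (1ℤ ≤? h u))))

      near-S⇒1≤h : ∀ {x u} → S x → x ~ᶜ u → 1ℤ ≤ h u
      near-S⇒1≤h {x} {u} Sx x~ᶜu = 1≤⟦⟧⇒ (1ℤ ≤? h u) (begin
        1ℤ              ≡⟨ ⟦⟧-yes (1ℤ ≤? h x) (S⇒1≤h Sx) ⟨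
        level 1ℤ x      ≡⟨ cut≤0⇒level-invariant (proj₁ level-one) x~ᶜu ⟩
        level 1ℤ u      ∎)
        where open ℤ.≤-Reasoning

      2∑adjacency*level≤flux : + 2 * ∑[ u < n ] (adjacency c u * level (+ 2) u) ≤ flux (+ 2)
      2∑adjacency*level≤flux = begin
        + 2 * ∑[ u < n ] (adjacency c u * level (+ 2) u)    ≡⟨ *-distribˡ-sum (+ 2) (λ u → adjacency c u * level (+ 2) u) ⟩
        ∑[ u < n ] (+ 2 * (adjacency c u * level (+ 2) u))  ≡⟨ sum-cong-≗ (λ u → swap (adjacency c u) (level (+ 2) u)) ⟩
        ∑[ u < n ] (adjacency c u * (+ 2 * level (+ 2) u))  ≤⟨ ∑-mono-≤ (λ u → ⟦⟧*-monoʳ-≤ (c ~? u) (t*⟦t≤i⟧≤i*⟦t≤i⟧ (+ 2) (h u))) ⟩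
        flux (+ 2)                                         ∎
        where
        open ℤ.≤-Reasoning
        swap : ∀ a x → + 2 * (a * x) ≡ a * (+ 2 * x)
        swap = solve-∀

      level+mass≤∑adjacency*level : ∀ {y} → ¬ S y → c ~ y →
        level (+ 2) y + mass (+ 2) ≤ ∑[ u < n ] (adjacency c u * level (+ 2) u)
      level+mass≤∑adjacency*level {y} ¬Sy c~y = begin
        level (+ 2) y + mass (+ 2)                                   ≡⟨ cong (_+ mass (+ 2)) (∑-⟦≟⟧ (level (+ 2)) y) ⟨
        ∑[ u < n ] (⟦ y ≟ u ⟧ * level (+ 2) u) + mass (+ 2)           ≡⟨ ∑-distrib-+ (λ u → ⟦ y ≟ u ⟧ * level (+ 2) u)
                                                                                     (λ u → ⟦ S? u ⟧ * level (+ 2) u) ⟨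
        ∑[ u < n ] (⟦ y ≟ u ⟧ * level (+ 2) u + ⟦ S? u ⟧ * level (+ 2) u)
                                                                     ≤⟨ ∑-mono-≤ term≤ ⟩
        ∑[ u < n ] (adjacency c u * level (+ 2) u)                    ∎
        where
        open ℤ.≤-Reasoning
        y+S⊆N[c] : ∀ u → ⟦ y ≟ u ⟧ + ⟦ S? u ⟧ ≤ adjacency c u
        y+S⊆N[c] u with y ≟ u | S? u
        ... | yes refl | yes Sy = ⊥-elim (¬Sy Sy)
        ... | yes refl | no _ = ℤ.≤-reflexive (sym (⟦⟧-yes (c ~? y) c~y))
        ... | no _ | yes Su = ℤ.≤-reflexive (sym (⟦⟧-yes (c ~? u) (S⊆N[c] Su)))
        ... | no _ | no _ = 0≤⟦⟧ (c ~? u)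
        factor : ∀ d s x → d * x + s * x ≡ x * (d + s)
        factor = solve-∀
        term≤ : ∀ u → ⟦ y ≟ u ⟧ * level (+ 2) u + ⟦ S? u ⟧ * level (+ 2) u ≤ adjacency c u * level (+ 2) u
        term≤ u = begin
          ⟦ y ≟ u ⟧ * level (+ 2) u + ⟦ S? u ⟧ * level (+ 2) u  ≡⟨ factor ⟦ y ≟ u ⟧ ⟦ S? u ⟧ (level (+ 2) u) ⟩
          level (+ 2) u * (⟦ y ≟ u ⟧ + ⟦ S? u ⟧)               ≤⟨ ⟦⟧*-monoʳ-≤ (+ 2 ≤? h u) (y+S⊆N[c] u) ⟩
          level (+ 2) u * adjacency c u                       ≡⟨ ℤ.*-comm (level (+ 2) u) (adjacency c u) ⟩
          adjacency c u * level (+ 2) u                       ∎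

      level-two : ∀ {y} → ¬ S y → c ~ y → cut (+ 2) ≤ 0ℤ × level (+ 2) y ≤ 0ℤ
      level-two {y} ¬Sy c~y = ℤ.≤-trans cut≤4l+cut 4l+cut≤0
                            , ℤ.*-cancelˡ-≤-pos (level (+ 2) y) 0ℤ (+ 4) (ℤ.≤-trans 4l≤4l+cut 4l+cut≤0)
        where
        open ℤ.≤-Reasoning
        l : ℤ
        l = level (+ 2) y
        4l+cut≤0 : + 4 * l + cut (+ 2) ≤ 0ℤ
        4l+cut≤0 = i+j≤i⇒j≤0 (begin
          + 4 * mass (+ 2) + (+ 4 * l + cut (+ 2))   ≡⟨ rearrange (mass (+ 2)) l (cut (+ 2)) ⟩
          + 2 * (+ 2 * (l + mass (+ 2))) + cut (+ 2) ≤⟨ ℤ.+-monoˡ-≤ (cut (+ 2)) (ℤ.*-monoˡ-≤-nonNeg (+ 2)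
                                                          (ℤ.*-monoˡ-≤-nonNeg (+ 2) (level+mass≤∑adjacency*level ¬Sy c~y))) ⟩
          + 2 * (+ 2 * ∑[ u < n ] (adjacency c u * level (+ 2) u)) + cut (+ 2)
                                                     ≤⟨ ℤ.+-monoˡ-≤ (cut (+ 2)) (ℤ.*-monoˡ-≤-nonNeg (+ 2) 2∑adjacency*level≤flux) ⟩
          + 2 * flux (+ 2) + cut (+ 2)               ≤⟨ energy-bound (+≤+ (s≤s z≤n)) ⟩
          + 4 * mass (+ 2)                           ∎)
          where
          rearrange : ∀ m a k → + 4 * m + (+ 4 * a + k) ≡ + 2 * (+ 2 * (a + m)) + k
          rearrange = solve-∀
        cut≤4l+cut : cut (+ 2) ≤ + 4 * l + cut (+ 2)
        cut≤4l+cut = ℤ.≤-trans (ℤ.≤-reflexive (sym (ℤ.+-identityˡ (cut (+ 2)))))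
                               (ℤ.+-monoˡ-≤ (cut (+ 2)) (ℤ.*-monoˡ-≤-nonNeg (+ 4) (0≤⟦⟧ (+ 2 ≤? h y))))
        4l≤4l+cut : + 4 * l ≤ + 4 * l + cut (+ 2)
        4l≤4l+cut = ℤ.≤-trans (ℤ.≤-reflexive (sym (ℤ.+-identityʳ (+ 4 * l)))) (ℤ.+-monoʳ-≤ (+ 4 * l) (cut-nonneg (+ 2)))

      h≤1 : ∀ {z y} → ¬ S y → c ~ y → Joinedᶜ z y → h z ≤ 1ℤ
      h≤1 {z} {y} ¬Sy c~y z⋯y = ℤ.i<j⇒i≤pred[j] (ℤ.≰⇒> (⟦⟧≤0⇒¬ (+ 2 ≤? h z) (begin
        level (+ 2) z     ≡⟨ z⋯y (level (+ 2)) (cut≤0⇒level-invariant (proj₁ (level-two ¬Sy c~y))) ⟩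
        level (+ 2) y     ≤⟨ proj₂ (level-two ¬Sy c~y) ⟩
        0ℤ                ∎)))
        where open ℤ.≤-Reasoning

      Δh≤1 : ∀ {z} → S z → h z ≡ 1ℤ → Δ adjacency h z ≤ 1ℤ
      Δh≤1 {z} Sz h[z]≡1 = begin
        ∑[ u < n ] (adjacency z u * (h z - h u))   ≤⟨ ∑-mono-≤ edge≤ ⟩
        ∑[ u < n ] (⟦ c ≟ u ⟧ * 1ℤ)                ≡⟨ ∑-⟦≟⟧ (λ _ → 1ℤ) c ⟩
        1ℤ                                        ∎
        where
        open ℤ.≤-Reasoning
        edge≤ : ∀ u → adjacency z u * (h z - h u) ≤ ⟦ c ≟ u ⟧ * 1ℤ
        edge≤ u with c ≟ u
        ... | yes refl = begin
          adjacency z c * (h z - h c)   ≡⟨ cong₂ (λ a b → adjacency z c * (a - b)) h[z]≡1 h[c]≡0 ⟩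
          adjacency z c * 1ℤ            ≡⟨ ℤ.*-identityʳ (adjacency z c) ⟩
          adjacency z c                 ≤⟨ ⟦⟧≤1 (z ~? c) ⟩
          1ℤ                            ∎
        ... | no c≢u = ⟦⟧*-nonpos (z ~? u) (λ z~u →
          ℤ.i≤j⇒i-j≤0 (subst (_≤ h u) (sym h[z]≡1) (near-S⇒1≤h Sz ((λ { refl → ¬S[c] Sz }) , (c≢u ∘ sym) , z~u))))

      twiceStar≡2 : ∀ {z} → S z → twiceStar c S? z ≡ + 2
      twiceStar≡2 {z} Sz = trans (cong₂ (λ s d → + 2 * (s - N * d)) (⟦⟧-yes (S? z) Sz) (⟦⟧-no (c ≟ z) (λ { refl → ¬S[c] Sz })))
                                 (simplify N)
        where
        simplify : ∀ N → + 2 * (1ℤ - N * 0ℤ) ≡ + 2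
        simplify = solve-∀

      Joinedᶜ⇒⊥ : ∀ {z y} → S z → ¬ S y → c ~ y → Joinedᶜ z y → ⊥
      Joinedᶜ⇒⊥ {z} Sz ¬Sy c~y z⋯y = 2≰1 (begin
        + 2                   ≡⟨ twiceStar≡2 Sz ⟨
        twiceStar c S? z      ≡⟨ Δh≡twiceStar z ⟨
        Δ adjacency h z       ≤⟨ Δh≤1 Sz (ℤ.≤-antisym (h≤1 ¬Sy c~y z⋯y) (S⇒1≤h Sz)) ⟩
        1ℤ                    ∎)
        where
        open ℤ.≤-Reasoning
        2≰1 : ¬ + 2 ≤ 1ℤ
        2≰1 (+≤+ (s≤s ()))

    twiceStar∉range-Δ : ∀ {z y} → S z → ¬ S y → c ~ y → Joinedᶜ z y → ∀ h → ¬ (∀ w → Δ adjacency h w ≡ twiceStar c S? w)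
    twiceStar∉range-Δ Sz ¬Sy c~y z⋯y h Δh≡twiceStar =
      Levels.Joinedᶜ⇒⊥ (λ w → h w - h c) (ℤ.+-inverseʳ (h c)) Δh′≡twiceStar Sz ¬Sy c~y z⋯y
      where
      Δh′≡twiceStar : ∀ w → Δ adjacency (λ x → h x - h c) w ≡ twiceStar c S? w
      Δh′≡twiceStar w = begin
        Δ adjacency (λ x → h x - h c) w                        ≡⟨ Δ-+ adjacency h (λ _ → - h c) w ⟩
        Δ adjacency h w + Δ adjacency (λ _ → - h c) w          ≡⟨ cong (_+_ (Δ adjacency h w)) (Δ-const adjacency (- h c) w) ⟩
        Δ adjacency h w + 0ℤ                                  ≡⟨ ℤ.+-identityʳ (Δ adjacency h w) ⟩
        Δ adjacency h w                                       ≡⟨ Δh≡twiceStar w ⟩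
        twiceStar c S? w                                           ∎
        where open ≡-Reasoning

module _ {A : Set} where

  ++-≡-++ : ∀ (a b c d : List A) → a ++ b ≡ c ++ d →
    (∃ λ m → c ≡ a ++ m × b ≡ m ++ d) ⊎ (∃ λ m → a ≡ c ++ m × d ≡ m ++ b)
  ++-≡-++ [] b c d eq = inj₁ (c , refl , eq)
  ++-≡-++ (x ∷ a) b [] d eq = inj₂ (x ∷ a , refl , sym eq)
  ++-≡-++ (x ∷ a) b (y ∷ c) d eq with ∷-injective eq
  ... | refl , eq′ with ++-≡-++ a b c d eq′
  ...   | inj₁ (m , refl , b≡) = inj₁ (m , refl , b≡)
  ...   | inj₂ (m , refl , d≡) = inj₂ (m , refl , d≡)

  CyclicEq-sym : ∀ {l l′ : List A} → CyclicEq l l′ → CyclicEq l′ l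
  CyclicEq-sym (p , q , refl , refl) = q , p , refl , refl

  CyclicEq-trans : ∀ {l l′ l″ : List A} → CyclicEq l l′ → CyclicEq l′ l″ → CyclicEq l l″
  CyclicEq-trans (p , q , refl , refl) (r , s , eq , refl) with ++-≡-++ q p r s eq
  ... | inj₁ (m , refl , refl) = m , s ++ q , ++-assoc m s q , sym (++-assoc s q m)
  ... | inj₂ (m , refl , refl) = p ++ r , m , sym (++-assoc p r m) , ++-assoc m p r

  Unique-++⁻ : ∀ (l : List A) {m} → Unique (l ++ m) → Unique l × Unique m × Disjoint l m
  Unique-++⁻ [] u = [] , u , λ ()
  Unique-++⁻ (x ∷ l) (x∉ ∷ u) with Unique-++⁻ l u
  ... | ul , um , l#m = Allₚ.++⁻ˡ l x∉ ∷ ul , um , x∷l#m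
    where
    x∷l#m : Disjoint (x ∷ l) _
    x∷l#m (here refl , x∈m) = All.lookup (Allₚ.++⁻ʳ l x∉) x∈m refl
    x∷l#m (there v∈l , v∈m) = l#m (v∈l , v∈m)

  Unique-rotate : ∀ {l l′ : List A} → CyclicEq l l′ → Unique l → Unique l′
  Unique-rotate (p , q , refl , refl) u with Unique-++⁻ p u
  ... | up , uq , p#q = Uniqueₚ.++⁺ uq up (λ (v∈q , v∈p) → p#q (v∈p , v∈q))

  ∈-rotate : ∀ {l l′ : List A} {v} → CyclicEq l l′ → v ∈ l → v ∈ l′
  ∈-rotate (p , q , refl , refl) v∈l with ∈-++⁻ p v∈l
  ... | inj₁ v∈p = ∈-++⁺ʳ q v∈p
  ... | inj₂ v∈q = ∈-++⁺ˡ v∈q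

  CyclicEq-∷-cancel : ∀ {a : A} {l m} → a ∉ l → CyclicEq (a ∷ l) (a ∷ m) → l ≡ m
  CyclicEq-∷-cancel {a} {l} a∉l ([] , q , refl , eq) = sym (∷-injectiveʳ (trans eq (++-identityʳ (a ∷ l))))
  CyclicEq-∷-cancel a∉l (a ∷ p , [] , refl , eq) = trans (++-identityʳ p) (sym (∷-injectiveʳ eq))
  CyclicEq-∷-cancel a∉l (a ∷ p , b ∷ q , refl , eq) with ∷-injective eq
  ... | refl , _ = ⊥-elim (a∉l (∈-++⁺ʳ p (here refl)))

  CyclicEq-filter : ∀ {P : A → Set} (P? : Decidable P) {l l′ : List A} → CyclicEq l l′ → CyclicEq (filter P? l) (filter P? l′)
  CyclicEq-filter P? (p , q , refl , refl) = filter P? p , filter P? q , filter-++ P? p q , filter-++ P? q p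

  Unique-reverse : ∀ {l : List A} → Unique l → Unique (reverse l)
  Unique-reverse {l} = Unique-resp-↭ (setoid A) (↭-sym (setoid A) (↭-reverse (setoid A) l))

  ∉-reverse : ∀ {l : List A} {x} → x ∉ l → x ∉ reverse l
  ∉-reverse {l} x∉l x∈ = x∉l (∈-resp-↭ (setoid A) (↭-reverse (setoid A) l) x∈)

  ++-∷-≡-[u,b,v] : ∀ {u b v : A} l m → u ≢ b → b ≢ v → l ++ b ∷ m ≡ u ∷ b ∷ v ∷ [] → l ≡ u ∷ [] × m ≡ v ∷ []
  ++-∷-≡-[u,b,v] [] m u≢b _ eq = ⊥-elim (u≢b (sym (∷-injectiveˡ eq)))
  ++-∷-≡-[u,b,v] (x ∷ []) m _ _ refl = refl , refl
  ++-∷-≡-[u,b,v] (x ∷ x′ ∷ []) m _ b≢v refl = ⊥-elim (b≢v refl)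
  ++-∷-≡-[u,b,v] (x ∷ x′ ∷ x″ ∷ l) m _ _ eq with ++-conicalʳ l (_ ∷ m) (∷-injectiveʳ (∷-injectiveʳ (∷-injectiveʳ eq)))
  ... | ()

module _ {A : Set} {R : A → A → Set} where

  Linked-++⁻ˡ : ∀ (l : List A) {m} → Linked R (l ++ m) → Linked R l
  Linked-++⁻ˡ [] _ = []
  Linked-++⁻ˡ (x ∷ []) _ = [-]
  Linked-++⁻ˡ (x ∷ y ∷ l) (r ∷ rs) = r ∷ Linked-++⁻ˡ (y ∷ l) rs

  Linked-last : ∀ (pre : List A) {u v} → Linked R (pre ++ u ∷ v ∷ []) → R u v
  Linked-last [] (r ∷ _) = r
  Linked-last (x ∷ []) (_ ∷ rs) = Linked-last [] rs
  Linked-last (x ∷ y ∷ pre) (_ ∷ rs) = Linked-last (y ∷ pre) rs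

  Linked-reverse : (∀ {x y} → R x y → R y x) → ∀ {l} → Linked R l → Linked R (reverse l)
  Linked-reverse R-sym [] = []
  Linked-reverse R-sym {x ∷ l} rs = onto [] x l [-] rs
    where
    onto : ∀ acc x l → Linked R (x ∷ acc) → Linked R (x ∷ l) → Linked R (reverseAcc (x ∷ acc) l)
    onto acc x [] racc _ = racc
    onto acc x (y ∷ l) racc (r ∷ rs) = onto (x ∷ acc) y l (R-sym r ∷ racc) rs

  Linked-ends : ∀ {B : Set} {P : A → Set} (f : A → B) → (∀ {u v} → P u → P v → R u v → f u ≡ f v) →
    ∀ {x} l {y} → All P (x ∷ l ++ y ∷ []) → Linked R (x ∷ l ++ y ∷ []) → f x ≡ f y
  Linked-ends f f-inv [] (px ∷ py ∷ []) (r ∷ _) = f-inv px py r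
  Linked-ends f f-inv (z ∷ l) (px ∷ pz ∷ ps) (r ∷ rs) = trans (f-inv px pz r) (Linked-ends f f-inv l (pz ∷ ps) rs)

module _ {n : ℕ} where
  open DecMembership (_≟_ {n}) using (_∈?_)

  ⟦∈∷⟧ : ∀ {x : Fin n} {L} → x ∉ L → ∀ u → ⟦ u ∈? x ∷ L ⟧ ≡ ⟦ x ≟ u ⟧ + ⟦ u ∈? L ⟧
  ⟦∈∷⟧ {x} {L} x∉L u with x ≟ u
  ... | yes refl = trans (⟦⟧-yes (x ∈? x ∷ L) (here refl)) (cong (_+_ 1ℤ) (sym (⟦⟧-no (x ∈? L) x∉L)))
  ... | no x≢u = trans (⟦⟧-cong (u ∈? x ∷ L) (u ∈? L) (λ { (here refl) → ⊥-elim (x≢u refl) ; (there u∈L) → u∈L }) there)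
                       (sym (ℤ.+-identityˡ ⟦ u ∈? L ⟧))

  foldr-map≡∑⟦∈⟧ : ∀ {L : List (Fin n)} → Unique L → (f : Fin n → ℤ) → foldr _+_ 0ℤ (map f L) ≡ ∑[ u < n ] (⟦ u ∈? L ⟧ * f u)
  foldr-map≡∑⟦∈⟧ {[]} [] f = sym (trans (sum-cong-≗ (λ u → cong (_* f u) (⟦⟧-no (u ∈? []) λ ()))) (sum-replicate-zero n))
  foldr-map≡∑⟦∈⟧ {x ∷ L} (x≢L ∷ uniq) f = begin
    f x + foldr _+_ 0ℤ (map f L)                               ≡⟨ cong₂ _+_ (∑-⟦≟⟧ f x) (sym (foldr-map≡∑⟦∈⟧ uniq f)) ⟨
    ∑[ u < n ] (⟦ x ≟ u ⟧ * f u) + ∑[ u < n ] (⟦ u ∈? L ⟧ * f u)  ≡⟨ ∑-distrib-+ (λ u → ⟦ x ≟ u ⟧ * f u) (λ u → ⟦ u ∈? L ⟧ * f u) ⟨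
    ∑[ u < n ] (⟦ x ≟ u ⟧ * f u + ⟦ u ∈? L ⟧ * f u)             ≡⟨ sum-cong-≗ (λ u → trans (sym (ℤ.*-distribʳ-+ (f u) ⟦ x ≟ u ⟧ ⟦ u ∈? L ⟧))
                                                                                    (cong (_* f u) (sym (⟦∈∷⟧ (Allₚ.All¬⇒¬Any x≢L) u)))) ⟩
    ∑[ u < n ] (⟦ u ∈? x ∷ L ⟧ * f u)                          ∎
    where open ≡-Reasoning

module _ (G : RibbonGraph) where
  open RibbonGraph G

  E-sym : ∀ {u v} → E u v → E v u
  E-sym {u} {v} e = trans (adj-sym v u) e

  E-irrefl : ∀ {v} → ¬ E v v
  E-irrefl {v} e with trans (sym e) (adj-irrefl v)
  ... | ()

  δ≡⟦≟⟧ : ∀ u w → δ G u w ≡ ⟦ u ≟ w ⟧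
  δ≡⟦≟⟧ u w with u ≟ w
  ... | yes _ = refl
  ... | no _ = refl

module _ (G : RibbonGraph) (c : Fin (RibbonGraph.V G)) (xs : List (Fin (RibbonGraph.V G))) where
  open RibbonGraph G
  open G1Defs G c xs

  G1Edge-sym : ∀ {u v} → G1Edge u v → G1Edge v u
  G1Edge-sym (inj₁ arc) = inj₂ arc
  G1Edge-sym (inj₂ arc) = inj₁ arc

  G1Edge-irrefl : ∀ {v} → ¬ G1Edge v v
  G1Edge-irrefl (inj₁ (_ , _ , _ , _ , _ , walk , _ , _ , pre , eq)) = E-irrefl G (Linked-last pre (subst (Linked E) eq walk))
  G1Edge-irrefl (inj₂ (_ , _ , _ , _ , _ , walk , _ , _ , pre , eq)) = E-irrefl G (Linked-last pre (subst (Linked E) eq walk))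

  G1Arc-from-c : ∀ {x} → x ∈ xs → E c x → G1Arc c x
  G1Arc-from-c {x} x∈xs c-x = [] , x , x , x∈xs , ([] , refl) , (c-x ∷ [-]) , (λ ()) , ([] ∷ []) , [] , refl

  -- `inner ++ [ z ]` is the part of the walk already traversed after leaving c.
  G1Arcs-along : ∀ {x} inner z rest → x ∈ xs → (∃ λ r → inner ++ z ∷ [] ≡ x ∷ r) →
    Linked E (c ∷ inner ++ z ∷ rest) → Unique (c ∷ inner ++ z ∷ rest) → Linked G1Arc (z ∷ rest)
  G1Arcs-along inner z [] _ _ _ _ = [-]
  G1Arcs-along {x} inner z (s ∷ rest) x∈xs (r , start) walk uniq =
      arc (proj₁ (Unique-++⁻ (c ∷ inner′ ++ s ∷ []) (subst Unique split uniq)))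
    ∷ G1Arcs-along inner′ s rest x∈xs (r ++ s ∷ [] , cong (_++ s ∷ []) start)
        (subst (Linked E) (cong (c ∷_) (sym (++-assoc inner (z ∷ []) (s ∷ rest)))) walk)
        (subst Unique (cong (c ∷_) (sym (++-assoc inner (z ∷ []) (s ∷ rest)))) uniq)
    where
    inner′ : List (Fin V)
    inner′ = inner ++ z ∷ []
    split : c ∷ inner ++ z ∷ s ∷ rest ≡ (c ∷ inner′ ++ s ∷ []) ++ rest
    split = cong (c ∷_) (trans (sym (++-assoc inner (z ∷ []) (s ∷ rest))) (sym (++-assoc inner′ (s ∷ []) rest)))
    arc : Unique (c ∷ inner′ ++ s ∷ []) → G1Arc z s
    arc (c∉ ∷ uniq′) =
        inner′ , s , x , x∈xs , (r ++ s ∷ [] , cong (_++ s ∷ []) start)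
      , Linked-++⁻ˡ (c ∷ inner′ ++ s ∷ []) (subst (Linked E) split walk)
      , Allₚ.All¬⇒¬Any (Allₚ.++⁻ˡ inner′ c∉) , uniq′
      , c ∷ inner , cong (c ∷_) (++-assoc inner (z ∷ []) (s ∷ []))

  G1Arc-into-c : ∀ {x} inner z → x ∈ xs → (∃ λ r → inner ++ z ∷ [] ≡ x ∷ r) →
    Linked E (c ∷ inner ++ z ∷ c ∷ []) → Unique (c ∷ inner ++ z ∷ []) → G1Arc z c
  G1Arc-into-c {x} inner z x∈xs (r , start) walk (c∉ ∷ uniq) =
    inner ++ z ∷ [] , c , x , x∈xs , (r ++ c ∷ [] , cong (_++ c ∷ []) start)
    , subst (Linked E) (cong (c ∷_) (sym (++-assoc inner (z ∷ []) (c ∷ [])))) walk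
    , Allₚ.All¬⇒¬Any c∉
    , Uniqueₚ.++⁺ uniq ([] ∷ []) (λ { (c∈ , here refl) → Allₚ.All¬⇒¬Any c∉ c∈ })
    , c ∷ inner , cong (c ∷_) (++-assoc inner (z ∷ []) (c ∷ []))

  open DecMembership (_≟_ {V}) using (_∈?_)

  D₀≡twiceStar : Unique xs → ∀ w → D₀ w ≡ twiceStar c (_∈? xs) w
  D₀≡twiceStar uniq w = cong (+ 2 *_) (begin
    sumℤ G (map (λ x → δ G x w - δ G c w) xs)
      ≡⟨ cong (foldr _+_ 0ℤ) (map-cong (λ x → cong₂ _-_ (δ≡⟦≟⟧ G x w) (δ≡⟦≟⟧ G c w)) xs) ⟩
    foldr _+_ 0ℤ (map (λ x → ⟦ x ≟ w ⟧ - ⟦ c ≟ w ⟧) xs)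
      ≡⟨ foldr-map≡∑⟦∈⟧ uniq (λ x → ⟦ x ≟ w ⟧ - ⟦ c ≟ w ⟧) ⟩
    ∑[ u < V ] (⟦ u ∈? xs ⟧ * (⟦ u ≟ w ⟧ - ⟦ c ≟ w ⟧))
      ≡⟨ sum-cong-≗ (λ u → *-distribˡ-- ⟦ u ∈? xs ⟧ ⟦ u ≟ w ⟧ ⟦ c ≟ w ⟧) ⟩
    ∑[ u < V ] (⟦ u ∈? xs ⟧ * ⟦ u ≟ w ⟧ - ⟦ u ∈? xs ⟧ * ⟦ c ≟ w ⟧)
      ≡⟨ ∑-distrib-- (λ u → ⟦ u ∈? xs ⟧ * ⟦ u ≟ w ⟧) (λ u → ⟦ u ∈? xs ⟧ * ⟦ c ≟ w ⟧) ⟩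
    ∑[ u < V ] (⟦ u ∈? xs ⟧ * ⟦ u ≟ w ⟧) - ∑[ u < V ] (⟦ u ∈? xs ⟧ * ⟦ c ≟ w ⟧)
      ≡⟨ cong₂ _-_ sift (sym (*-distribʳ-sum ⟦ c ≟ w ⟧ (λ u → ⟦ u ∈? xs ⟧))) ⟩
    ⟦ w ∈? xs ⟧ - sum (λ u → ⟦ u ∈? xs ⟧) * ⟦ c ≟ w ⟧ ∎)
    where
    open ≡-Reasoning
    sift : ∑[ u < V ] (⟦ u ∈? xs ⟧ * ⟦ u ≟ w ⟧) ≡ ⟦ w ∈? xs ⟧
    sift = trans (sum-cong-≗ (λ u → trans (ℤ.*-comm ⟦ u ∈? xs ⟧ ⟦ u ≟ w ⟧)
                                         (cong (_* ⟦ u ∈? xs ⟧) (⟦⟧-cong (u ≟ w) (w ≟ u) sym sym))))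
                 (∑-⟦≟⟧ (λ u → ⟦ u ∈? xs ⟧) w)

  module _ (G1Edge? : ∀ u v → Dec (G1Edge u v)) where

    Span⇒range-Δ : ∀ {D} → Span D → ∃ λ g → ∀ w → D w ≡ Δ (adjacency G1Edge?) g w
    Span⇒range-Δ (span-zero D D≡0) = (λ _ → 0ℤ) , λ w → trans (D≡0 w) (sym (Δ-const (adjacency G1Edge?) 0ℤ w))
    Span⇒range-Δ (span-gen D (v , _ , L , uniq , L⇔N[v] , D≡)) = (λ u → ⟦ v ≟ u ⟧) , λ w → begin
      D w
        ≡⟨ D≡ w ⟩
      sumℤ G (map (λ u → δ G v w - δ G u w) L)
        ≡⟨ cong (foldr _+_ 0ℤ) (map-cong (λ u → cong₂ _-_ (δ≡⟦≟⟧ G v w) (δ≡⟦≟⟧ G u w)) L) ⟩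
      foldr _+_ 0ℤ (map (λ u → ⟦ v ≟ w ⟧ - ⟦ u ≟ w ⟧) L)
        ≡⟨ foldr-map≡∑⟦∈⟧ uniq (λ u → ⟦ v ≟ w ⟧ - ⟦ u ≟ w ⟧) ⟩
      ∑[ u < V ] (⟦ u ∈? L ⟧ * (⟦ v ≟ w ⟧ - ⟦ u ≟ w ⟧))
        ≡⟨ sum-cong-≗ (λ u → cong (_* (⟦ v ≟ w ⟧ - ⟦ u ≟ w ⟧))
                                  (⟦⟧-cong (u ∈? L) (G1Edge? v u) (Equivalence.to (L⇔N[v] u)) (Equivalence.from (L⇔N[v] u)))) ⟩
      ∑[ u < V ] (adjacency G1Edge? v u * (⟦ v ≟ w ⟧ - ⟦ u ≟ w ⟧))
        ≡⟨ Δ-⟦≟⟧ (adjacency G1Edge?) (adjacency-sym G1Edge? G1Edge-sym) v w ⟨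
      Δ (adjacency G1Edge?) (λ u → ⟦ v ≟ u ⟧) w ∎
      where open ≡-Reasoning
    Span⇒range-Δ (span-add D D₁ D₂ span₁ span₂ D≡) with Span⇒range-Δ span₁ | Span⇒range-Δ span₂
    ... | g₁ , D₁≡ | g₂ , D₂≡ = (λ x → g₁ x + g₂ x) , λ w →
      trans (D≡ w) (trans (cong₂ _+_ (D₁≡ w) (D₂≡ w)) (sym (Δ-+ (adjacency G1Edge?) g₁ g₂ w)))
    Span⇒range-Δ (span-neg D D₁ span₁ D≡) with Span⇒range-Δ span₁
    ... | g , D₁≡ = (λ x → - g x) , λ w →
      trans (D≡ w) (trans (cong -_ (D₁≡ w)) (sym (Δ-neg (adjacency G1Edge?) g w)))

¬¬-∀-Fin : ∀ {n} {P : Fin n → Set} → (∀ i → ¬ ¬ P i) → ¬ ¬ (∀ i → P i)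
¬¬-∀-Fin {zero} _ ¬∀ = ¬∀ (λ ())
¬¬-∀-Fin {suc n} ¬¬P ¬∀ = ¬¬P zero (λ p₀ → ¬¬-∀-Fin (¬¬P ∘ suc) (λ ps → ¬∀ (λ { zero → p₀ ; (suc i) → ps i })))

module _ (G : RibbonGraph) (H : TypeII G) {xs ys : List (Fin (RibbonGraph.V G))}
         (cyc : CyclicEq (RibbonGraph.rot G (TypeII.c H)) (TypeII.a₁ H ∷ xs ++ TypeII.aₙ H ∷ ys)) where
  open RibbonGraph G
  open TypeII H
  open DecMembership (_≟_ {V}) using (_∈?_)

  -- Restricted to a₁, f_k, aₙ, f₁, the rotation (a₁, x₁ … x_N, aₙ, y₁ … y_M) must read (a₁, f_k, aₙ, f₁).
  private
    S₄ : List (Fin V)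
    S₄ = a₁ ∷ fₖ ∷ aₙ ∷ f₁ ∷ []

    a₁∷xs∷aₙ∷ys-unique : Unique (a₁ ∷ xs ++ aₙ ∷ ys)
    a₁∷xs∷aₙ∷ys-unique = Unique-rotate cyc (rot-unique c)

    xs∷aₙ∷ys-unique : Unique (xs ++ aₙ ∷ ys)
    xs∷aₙ∷ys-unique with a₁∷xs∷aₙ∷ys-unique
    ... | _ ∷ uniq = uniq

    a₁∉xs∷aₙ∷ys : a₁ ∉ xs ++ aₙ ∷ ys
    a₁∉xs∷aₙ∷ys with a₁∷xs∷aₙ∷ys-unique
    ... | a₁∉ ∷ _ = Allₚ.All¬⇒¬Any a₁∉

    as∷fs-unique : Unique (as ++ fs)
    as∷fs-unique with distinct
    ... | _ ∷ uniq = uniq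

    c∉fs : c ∉ fs
    c∉fs with distinct
    ... | c∉ ∷ _ = Allₚ.All¬⇒¬Any c∉ ∘ ∈-++⁺ʳ as

    aₙ∉fs : aₙ ∉ fs
    aₙ∉fs aₙ∈fs = proj₂ (proj₂ (Unique-++⁻ as as∷fs-unique)) (there (∈-++⁺ʳ aMid (here refl)) , aₙ∈fs)

    restrict-xs∷aₙ∷ys : restrict G S₄ (xs ++ aₙ ∷ ys) ≡ fₖ ∷ aₙ ∷ f₁ ∷ []
    restrict-xs∷aₙ∷ys = CyclicEq-∷-cancel a₁∉ (CyclicEq-trans (CyclicEq-sym rotated) order)
      where
      rotated : CyclicEq (restrict G S₄ (rot c)) (a₁ ∷ restrict G S₄ (xs ++ aₙ ∷ ys))
      rotated = subst (CyclicEq (restrict G S₄ (rot c))) (filter-accept (_∈? S₄) (here refl)) (CyclicEq-filter (_∈? S₄) cyc)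
      a₁∉ : a₁ ∉ restrict G S₄ (xs ++ aₙ ∷ ys)
      a₁∉ = a₁∉xs∷aₙ∷ys ∘ proj₁ ∘ ∈-filter⁻ (_∈? S₄)

    restrict-xs∧ys : restrict G S₄ xs ≡ fₖ ∷ [] × restrict G S₄ ys ≡ f₁ ∷ []
    restrict-xs∧ys = ++-∷-≡-[u,b,v] (restrict G S₄ xs) (restrict G S₄ ys)
      (λ fₖ≡aₙ → aₙ∉fs (subst (_∈ fs) fₖ≡aₙ (there (∈-++⁺ʳ fMid (here refl)))))
      (λ aₙ≡f₁ → aₙ∉fs (subst (_∈ fs) (sym aₙ≡f₁) (here refl)))
      (trans (sym (trans (filter-++ (_∈? S₄) xs (aₙ ∷ ys)) (cong (restrict G S₄ xs ++_) (filter-accept (_∈? S₄) (there (there (here refl)))))))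
             restrict-xs∷aₙ∷ys)

    reverse-fs : reverse fs ≡ fₖ ∷ reverse fMid ++ f₁ ∷ []
    reverse-fs = trans (unfold-reverse f₁ (fMid ++ fₖ ∷ [])) (cong (_++ f₁ ∷ []) (reverse-++ fMid (fₖ ∷ [])))

    reversed-cycleF : Linked E (c ∷ (fₖ ∷ reverse fMid) ++ f₁ ∷ c ∷ [])
    reversed-cycleF = subst (Linked E) reverse-cycle (Linked-reverse (E-sym G) cycleF)
      where
      reverse-cycle : reverse (c ∷ fs ++ c ∷ []) ≡ c ∷ (fₖ ∷ reverse fMid) ++ f₁ ∷ c ∷ []
      reverse-cycle = begin
        reverse (c ∷ fs ++ c ∷ [])                   ≡⟨ unfold-reverse c (fs ++ c ∷ []) ⟩
        reverse (fs ++ c ∷ []) ++ c ∷ []              ≡⟨ cong (_++ c ∷ []) (reverse-++ fs (c ∷ [])) ⟩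
        c ∷ reverse fs ++ c ∷ []                      ≡⟨ cong (λ l → c ∷ l ++ c ∷ []) reverse-fs ⟩
        c ∷ ((fₖ ∷ reverse fMid) ++ f₁ ∷ []) ++ c ∷ [] ≡⟨ cong (c ∷_) (++-assoc (fₖ ∷ reverse fMid) (f₁ ∷ []) (c ∷ [])) ⟩
        c ∷ (fₖ ∷ reverse fMid) ++ f₁ ∷ c ∷ []        ∎
        where open ≡-Reasoning

    reversed-walk-unique : Unique (c ∷ fₖ ∷ reverse fMid ++ f₁ ∷ [])
    reversed-walk-unique with distinct
    ... | _ ∷ uniq = subst (λ l → Unique (c ∷ l)) reverse-fs
                       (Allₚ.¬Any⇒All¬ (reverse fs) (∉-reverse c∉fs) ∷ Unique-reverse (proj₁ (proj₂ (Unique-++⁻ as uniq))))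

  xs-unique : Unique xs
  xs-unique = proj₁ (Unique-++⁻ xs xs∷aₙ∷ys-unique)

  E-c-xs : ∀ {x} → x ∈ xs → E c x
  E-c-xs {x} x∈xs = Equivalence.to (rot-nbrs c x) (∈-rotate (CyclicEq-sym cyc) (there (∈-++⁺ˡ x∈xs)))

  fₖ∈xs : fₖ ∈ xs
  fₖ∈xs = proj₁ (∈-filter⁻ (_∈? S₄) (subst (fₖ ∈_) (sym (proj₁ restrict-xs∧ys)) (here refl)))

  f₁∉xs : f₁ ∉ xs
  f₁∉xs f₁∈xs = proj₂ (proj₂ (Unique-++⁻ xs xs∷aₙ∷ys-unique))
    (f₁∈xs , there (proj₁ (∈-filter⁻ (_∈? S₄) (subst (f₁ ∈_) (sym (proj₂ restrict-xs∧ys)) (here refl)))))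

  open G1Defs G c xs using (G1Arc; G1Edge)

  fₖ⋯f₁-arcs : Linked G1Arc (fₖ ∷ reverse fMid ++ f₁ ∷ [])
  fₖ⋯f₁-arcs = G1Arcs-along G c xs [] fₖ (reverse fMid ++ f₁ ∷ []) fₖ∈xs ([] , refl)
    (Linked-++⁻ˡ (c ∷ fₖ ∷ reverse fMid ++ f₁ ∷ [])
      (subst (Linked E) (cong (c ∷_) (sym (++-assoc (fₖ ∷ reverse fMid) (f₁ ∷ []) (c ∷ [])))) reversed-cycleF))
    reversed-walk-unique

  f₁-c-arc : G1Arc f₁ c
  f₁-c-arc = G1Arc-into-c G c xs (fₖ ∷ reverse fMid) f₁ fₖ∈xs (reverse fMid ++ f₁ ∷ [] , refl) reversed-cycleF reversed-walk-unique

  fₖ⋯f₁ : Avoiding.Joinedᶜ G1Edge c fₖ f₁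
  fₖ⋯f₁ φ φ-inv = Linked-ends φ (λ u≢c v≢c arc → φ-inv (u≢c , v≢c , inj₁ arc)) (reverse fMid) off-c fₖ⋯f₁-arcs
    where
    off-c : All (λ v → ¬ v ≡ c) (fₖ ∷ reverse fMid ++ f₁ ∷ [])
    off-c with reversed-walk-unique
    ... | c≢ ∷ _ = All.map (λ c≢v v≡c → c≢v (sym v≡c)) c≢

lemma4p4 : (G : RibbonGraph) (H : TypeII G) (xs ys : List (Fin (RibbonGraph.V G))) →
    CyclicEq (RibbonGraph.rot G (TypeII.c H)) (TypeII.a₁ H ∷ xs ++ TypeII.aₙ H ∷ ys) →
    (∀ a → a ∈ TypeII.as H → ¬ G1Defs.InG1 G (TypeII.c H) xs a) →
    ¬ G1Defs._∼₁_ G (TypeII.c H) xs (G1Defs.D₀ G (TypeII.c H) xs) (G1Defs.zeroDiv G (TypeII.c H) xs)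
-- Adjacency in G₁ is not decidable constructively, but the
-- goal is a negation, so it may be decided under a double negation.
lemma4p4 G H xs ys cyc _ D₀∼₁0 =
  ¬¬-∀-Fin (λ u → ¬¬-∀-Fin (λ v → ¬¬-excluded-middle)) λ G1Edge? →
    let g , D₀≡Δg = Span⇒range-Δ G c xs G1Edge? D₀∼₁0 in
    twiceStar∉range-Δ G1Edge? (G1Edge-sym G c xs) (G1Edge-irrefl G c xs) c (_∈? xs)
      (λ x∈xs → inj₁ (G1Arc-from-c G c xs x∈xs (E-c-xs G H cyc x∈xs)))
      (fₖ∈xs G H cyc) (f₁∉xs G H cyc) (inj₂ (f₁-c-arc G H cyc)) (fₖ⋯f₁ G H cyc) g
      (λ w → trans (sym (D₀≡Δg w)) (trans (ℤ.+-identityʳ _) (D₀≡twiceStar G c xs (xs-unique G H cyc) w)))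
  where
  open RibbonGraph G using (V)
  open TypeII H using (c)
  open DecMembership (_≟_ {V}) using (_∈?_)
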